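{- For any type $A$, its type of isolated points $A^{\circ}$ is discrete, hence a set.
   Context: Work in Homotopy Type Theory with a univalent universe. A point $a:A$ is isolated if $a=b$ is decidable for every $b:A$; $A^{\circ}:=\sum_{a:A}\prod_{b:A}\mathrm{Dec}(a=b)$. A type is discrete if its equality is decidable. -}

module Defs where

open import Level using (Level)
open import Data.Product using (Σ)
open import Relation.Nullary using (Dec)
open import Relation.Binary.PropositionalEquality using (_≡_)

isIsolated : {ℓ : Level} {A : Set ℓ} → A → Set ℓ
isIsolated {A = A} a = (b : A) → Dec (a ≡ b)

Isolated : {ℓ : Level} → Set ℓ → Set ℓ
Isolated A = Σ A isIsolated

-- Hedberg's argument works pointwise: deciding a ≡ b gives a constant endofunction
-- of a ≡ b, which forces a ≡ b to be a proposition. With function extensionality,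
-- being isolated is then a proposition, so two isolated points are equal exactly
-- when their underlying points are, and that is decided by either isolation witness.
-- A discrete type satisfies UIP by Hedberg's theorem.
module Submission where

open import Defs
open import Level using (Level; 0ℓ)
open import Data.Product using (_×_; _,_; proj₁)
open import Data.Empty using (⊥-elim)
open import Relation.Nullary using (¬_; Dec; yes; no)
open import Relation.Nullary.Irrelevant using (Irrelevant)
open import Relation.Nullary.Decidable.Core using (recompute; recompute-constant)
open import Relation.Binary.PropositionalEquality
open import Relation.Binary.Definitions using (DecidableEquality)
open import Axiom.UniquenessOfIdentityProofs using (UIP; module Decidable⇒UIP)
open import Axiom.Extensionality.Propositional using (Extensionality; lower-extensionality)

private
  variable
    ℓ : Level

isIsolated⇒≡-irrelevant : {A : Set ℓ} {a : A} → isIsolated a → (b : A) → Irrelevant (a ≡ b)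
isIsolated⇒≡-irrelevant {A = A} {a = a} a≟_ b p q = begin
  p                                          ≡⟨ sym (≡-canonical p) ⟩
  trans (sym (normalise refl)) (normalise p) ≡⟨ cong (trans _) (recompute-constant (a≟ b) p q) ⟩
  trans (sym (normalise refl)) (normalise q) ≡⟨ ≡-canonical q ⟩
  q                                          ∎
  where
  open ≡-Reasoning

  normalise : {c : A} → a ≡ c → a ≡ c
  normalise {c} r = recompute (a≟ c) r

  ≡-canonical : {c : A} (r : a ≡ c) → trans (sym (normalise refl)) (normalise r) ≡ r
  ≡-canonical refl = trans-symˡ (normalise refl)

¬-irrelevant : {A : Set ℓ} → Extensionality ℓ 0ℓ → Irrelevant (¬ A)
¬-irrelevant ext ¬p ¬q = ext (λ p → ⊥-elim (¬p p))

Dec-irrelevant : {A : Set ℓ} → Extensionality ℓ 0ℓ → Irrelevant A → Irrelevant (Dec A)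
Dec-irrelevant ext irr (yes p) (yes q) = cong yes (irr p q)
Dec-irrelevant ext irr (yes p) (no ¬q) = ⊥-elim (¬q p)
Dec-irrelevant ext irr (no ¬p) (yes q) = ⊥-elim (¬p q)
Dec-irrelevant ext irr (no ¬p) (no ¬q) = cong no (¬-irrelevant ext ¬p ¬q)

isIsolated-irrelevant : {A : Set ℓ} → Extensionality ℓ ℓ → (a : A) → Irrelevant (isIsolated a)
isIsolated-irrelevant {ℓ} ext a f g = ext λ b →
  Dec-irrelevant (lower-extensionality 0ℓ ℓ ext) (isIsolated⇒≡-irrelevant f b) (f b) (g b)

Isolated-≟ : {A : Set ℓ} → Extensionality ℓ ℓ → DecidableEquality (Isolated A)
Isolated-≟ ext (a , f) (b , g) with f b
... | no a≢b   = no (λ e → a≢b (cong proj₁ e))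
... | yes refl = yes (cong (a ,_) (isIsolated-irrelevant ext a f g))

proposition2p4 : {ℓ : Level} → Extensionality ℓ ℓ → (A : Set ℓ)
    → DecidableEquality (Isolated A) × UIP (Isolated A)
proposition2p4 ext A = Isolated-≟ ext , Decidable⇒UIP.≡-irrelevant (Isolated-≟ ext)
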